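{- There is a sequence of positive constants $(a_i)_{i\ge 0}$ such that for every graph $G$ without isolated vertices, every uniform NROBP realizing $\phi(G)$ has at least $2^{\mathrm{dmw}(G)/a_x}$ nodes, where $x$ is the maximum degree of $G$.
   Context: For a graph $G$ with no isolated vertices, $\phi(G)$ is the monotone 2-CNF with variables $\{x_v : v\in V(G)\}$ and clauses $\{(x_u\vee x_v): \{u,v\}\in E(G)\}$. An NROBP realizing a Boolean function $F$ is a connected directed acyclic graph (multiple edges allowed) with one root and one leaf, in which some edges are labelled by literals of variables of $F$ so that no directed path contains two edges labelled by literals of the same variable; writing $A(P)$ for the set of literals on a path $P$: (i) for every root-to-leaf path $P$, every extension of $A(P)$ to a total assignment satisfies $F$; (ii) for every satisfying assignment $A$ of $F$ there is a root-to-leaf path $P$ with $A(P)\subseteq A$. It is uniform if any two paths from the root to the same node are labelled by literals of the same set of variables, and every root-to-leaf path is labelled by literals of all variables of $F$. A matching $M$ of $G$ is distant if no two vertices incident to distinct edges of $M$ are adjacent or have a common neighbour. $\mathrm{dmw}(G)$ (distant matching width) is the minimum, over all orderings $SV$ of $V(G)$, of the maximum, over all prefixes $V_1$ of $SV$, of the size of a largest distant matching all of whose edges have one end in $V_1$ and the other in $V(G)\setminus V_1$. -}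

module Defs where

open import Data.Nat using (ℕ; zero; suc; _+_; _<_; _≤_; _⊔_)
open import Data.Fin using (Fin; toℕ)
open import Data.Bool using (Bool; true; false; if_then_else_)
open import Data.Maybe using (Maybe; just; nothing)
open import Data.List using (List; []; _∷_; map; foldr; allFin)
open import Data.Nat.ListAction using (sum)
open import Data.List.Membership.Propositional using (_∈_)
open import Data.List.Relation.Unary.All using (All)
open import Data.List.Relation.Unary.Unique.Propositional using (Unique)
open import Data.Product using (Σ; ∃; _×_; _,_; proj₁; proj₂)
open import Data.Sum using (_⊎_)
open import Data.Empty using (⊥)
open import Relation.Nullary using (¬_)
open import Relation.Binary.PropositionalEquality using (_≡_; _≢_)
open import Function.Definitions using (Injective)

record Graph (n : ℕ) : Set where
  field
    adj     : Fin n → Fin n → Bool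
    adj-sym : ∀ u v → adj u v ≡ adj v u
    irrefl  : ∀ u → adj u u ≡ false

module _ {n : ℕ} (G : Graph n) where
  open Graph G

  Adj : Fin n → Fin n → Set
  Adj u v = adj u v ≡ true

  NoIsolated : Set
  NoIsolated = ∀ v → ∃ λ u → Adj v u

  degree : Fin n → ℕ
  degree v = sum (map (λ u → if adj v u then 1 else 0) (allFin n))

  maxDegree : ℕ
  maxDegree = foldr (λ v m → degree v ⊔ m) 0 (allFin n)

  SatPhi : (Fin n → Bool) → Set
  SatPhi A = ∀ u v → Adj u v → (A u ≡ true) ⊎ (A v ≡ true)

  -- an ordering SV of V(G), given by the (injective) position map
  Ordering : Set
  Ordering = Σ (Fin n → Fin n) (Injective _≡_ _≡_)

  InPrefix : Ordering → ℕ → Fin n → Set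
  InPrefix σ i v = toℕ (proj₁ σ v) < i

  Incident : Fin n → Fin n × Fin n → Set
  Incident x e = (x ≡ proj₁ e) ⊎ (x ≡ proj₂ e)

  IsDistantMatching : {k : ℕ} → (Fin k → Fin n × Fin n) → Set
  IsDistantMatching {k} M =
    (∀ i → Adj (proj₁ (M i)) (proj₂ (M i))) ×
    (∀ i j → i ≢ j → ∀ x y → Incident x (M i) → Incident y (M j) →
       (x ≢ y) × (¬ Adj x y) × (¬ (∃ λ w → Adj x w × Adj w y)))

  CrossingDistantMatching : Ordering → ℕ → {k : ℕ} → (Fin k → Fin n × Fin n) → Set
  CrossingDistantMatching σ i M =
    IsDistantMatching M ×
    (∀ j → InPrefix σ i (proj₁ (M j)) × ¬ InPrefix σ i (proj₂ (M j)))

  -- dmw(G) ≡ d : d is the minimum over orderings of the maximum over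
  -- prefixes of the largest crossing distant matching
  IsDMW : ℕ → Set
  IsDMW d =
    (Σ Ordering λ σ → ∀ (i : Fin (suc n)) (m : ℕ) (M : Fin m → Fin n × Fin n) →
        CrossingDistantMatching σ (toℕ i) M → m ≤ d) ×
    (∀ (σ : Ordering) → Σ (Fin (suc n)) λ i → Σ (Fin d → Fin n × Fin n) λ M →
        CrossingDistantMatching σ (toℕ i) M)

-- Branching programs over variables Fin n.
-- A label (v , true) is the literal x_v, (v , false) is ¬x_v.

record BP (n : ℕ) : Set where
  field
    nodes : ℕ
    edges : ℕ
    src   : Fin edges → Fin nodes
    tgt   : Fin edges → Fin nodes
    lab   : Fin edges → Maybe (Fin n × Bool)
    root  : Fin nodes
    leaf  : Fin nodes

module _ {n : ℕ} (B : BP n) where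
  open BP B

  data Path : Fin nodes → Fin nodes → Set where
    []  : ∀ {u} → Path u u
    _∷_ : ∀ {v} (e : Fin edges) → Path (tgt e) v → Path (src e) v

  literals : ∀ {u v} → Path u v → List (Fin n × Bool)
  literals [] = []
  literals (e ∷ p) with lab e
  ... | just l  = l ∷ literals p
  ... | nothing = literals p

  vars : ∀ {u v} → Path u v → List (Fin n)
  vars p = map proj₁ (literals p)

  Acyclic : Set
  Acyclic = ∀ (e : Fin edges) → Path (tgt e) (src e) → ⊥

  RootLeaf : Set
  RootLeaf =
    (∀ u → (u ≡ root → ∀ e → tgt e ≢ u) × ((∀ e → tgt e ≢ u) → u ≡ root)) ×
    (∀ u → (u ≡ leaf → ∀ e → src e ≢ u) × ((∀ e → src e ≢ u) → u ≡ leaf))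

  ReadOnce : Set
  ReadOnce = ∀ u v (p : Path u v) → Unique (vars p)

  Extends : (Fin n → Bool) → List (Fin n × Bool) → Set
  Extends A ls = All (λ l → A (proj₁ l) ≡ proj₂ l) ls

  Realizes : ((Fin n → Bool) → Set) → Set
  Realizes F =
    (∀ (p : Path root leaf) (A : Fin n → Bool) → Extends A (literals p) → F A) ×
    (∀ (A : Fin n → Bool) → F A → Σ (Path root leaf) λ p → Extends A (literals p))

  IsNROBP : ((Fin n → Bool) → Set) → Set
  IsNROBP F = Acyclic × RootLeaf × ReadOnce × Realizes F

  Uniform : Set
  Uniform =
    (∀ u (p q : Path root u) (x : Fin n) → x ∈ vars p → x ∈ vars q) ×
    (∀ (p : Path root leaf) (x : Fin n) → x ∈ vars p)

-- Let A be a satisfying assignment and p an accepting path for it. By uniformity p reads every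
-- variable, and by read-onceness each exactly once, so the order in which p reads them is an
-- ordering of V(G); by the definition of dmw some prefix of it is crossed by a distant matching
-- M of size d = dmw(G). Cutting p after that prefix sends A to a node u. For two assignments
-- sent to the same u, uniformity and read-onceness let one splice the prefix of the first with
-- the suffix of the second into an accepting path, so for every edge of M one endpoint is true
-- in all assignments sent to u. These endpoints form an independent set W. For w ∈ W, setting
-- w false and its neighbours true keeps φ(G) satisfied, leaves the rest of W untouched and is
-- at most K = 2^(Δ+1) to one; so at most a fraction (K/(K+1))^d of the satisfying assignments
-- is sent to u. Hence (K+1)^d ≤ N·K^d for N nodes, and (1+1/K)^K ≥ 2 gives 2^d ≤ N^K.

module Submission where

open import Defs
open import Data.Bool using (Bool; true; false; if_then_else_; _∨_; not)
import Data.Bool.Properties as Bool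
open import Data.Empty using (⊥-elim)
open import Data.Fin using (Fin; zero; suc; toℕ; fromℕ<)
import Data.Fin.Properties as Fin
open import Data.Fin.Properties using (all?; ¬∀⟶∃¬; injective⇒≤; toℕ-fromℕ<)
  renaming (_≟_ to _≟ᶠ_)
open import Data.List using (List; []; _∷_; tabulate; foldr; map; take; length; lookup; _++_)
open import Data.List.Properties using (map-tabulate; map-++; take-map)
open import Data.List.Membership.Propositional using (_∈_; _∉_)
open import Data.List.Membership.Propositional.Properties
  using (∈-allFin; ∈-lookup; ∈-++⁺ʳ; ∈-map⁺)
import Data.List.Membership.DecPropositional as DecMembership
import Data.List.Relation.Unary.All as All
import Data.List.Relation.Unary.All.Properties as All
open import Data.List.Relation.Unary.AllPairs using (_∷_)
open import Data.List.Relation.Unary.Any using (here; there)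
open import Data.List.Relation.Unary.Unique.Propositional using (Unique)
open import Data.Maybe using (just; nothing)
open import Data.Nat
  using (ℕ; zero; suc; _+_; _*_; _<_; _≤_; _^_; _⊔_; z≤n; s≤s; NonZero; >-nonZero)
import Data.Nat.ListAction as List
open import Data.Nat.Properties
open import Data.Nat.Tactic.RingSolver using (solve-∀)
open import Data.Product using (Σ; ∃; _×_; _,_; proj₁; proj₂)
open import Data.Sum using (_⊎_; inj₁; inj₂)
import Data.Sum as Sum
open import Data.Vec.Functional using (Vector; tail) renaming ([] to nil; _∷_ to _◂_)
open import Function using (_∘_; _⇔_; mk⇔; Equivalence)
open import Function.Definitions using (Injective)
open import Level using (0ℓ)
open import Relation.Binary.Definitions using (_Respects_; DecidableEquality)
open import Relation.Binary.PropositionalEquality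
open import Relation.Nullary using (Dec; yes; no; does; ¬_; contradiction)
open import Relation.Nullary.Decidable using (dec-true; dec-false; _×-dec_; _→-dec_; _⊎-dec_)
open import Relation.Unary using (Pred; Decidable; _⊆_; _∩_; ∁; Empty)
open import Relation.Unary.Properties using (_∩?_; ∁?)

open import Algebra.Properties.CommutativeSemigroup +-commutativeSemigroup
  using () renaming (interchange to +-interchange)
open import Algebra.Properties.CommutativeSemigroup *-commutativeSemigroup
  using () renaming (x∙yz≈y∙xz to *-left-comm; interchange to *-interchange)
open import Algebra.Properties.Semiring.Sum +-*-semiring using (sum; ∑-distrib-+; *-distribʳ-sum)

∑-mono-≤ : ∀ {m} {f g : Fin m → ℕ} → (∀ i → f i ≤ g i) → sum f ≤ sum g
∑-mono-≤ {zero}  f≤g = z≤n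
∑-mono-≤ {suc m} f≤g = +-mono-≤ (f≤g zero) (∑-mono-≤ (f≤g ∘ suc))

≤-∑ : ∀ {m} (f : Fin m → ℕ) i → f i ≤ sum f
≤-∑ f zero    = m≤m+n _ _
≤-∑ f (suc i) = ≤-trans (≤-∑ (tail f) i) (m≤n+m _ _)

∑-const : ∀ m c → sum {m} (λ _ → c) ≡ m * c
∑-const zero    c = refl
∑-const (suc m) c = cong (c +_) (∑-const m c)

*-suc-≤ : ∀ {a b k} → a ≤ k * b → a * suc k ≤ k * (a + b)
*-suc-≤ {a} {b} {k} a≤kb = begin
  a * suc k      ≡⟨ *-suc a k ⟩
  a + a * k      ≤⟨ +-monoˡ-≤ (a * k) a≤kb ⟩
  k * b + a * k  ≡⟨ cong (k * b +_) (*-comm a k) ⟩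
  k * b + k * a  ≡⟨ *-distribˡ-+ k b a ⟨
  k * (b + a)    ≡⟨ cong (k *_) (+-comm b a) ⟩
  k * (a + b)    ∎
  where open ≤-Reasoning

List-sum-tabulate : ∀ {m} (f : Fin m → ℕ) → List.sum (tabulate f) ≡ sum f
List-sum-tabulate {zero}  f = refl
List-sum-tabulate {suc m} f = cong (f zero +_) (List-sum-tabulate (f ∘ suc))

≤-foldr-⊔ : ∀ {A : Set} (f : A → ℕ) {x} {xs : List A} →
            x ∈ xs → f x ≤ foldr (λ y m → f y ⊔ m) 0 xs
≤-foldr-⊔ f (here refl) = m≤m⊔n _ _
≤-foldr-⊔ f (there x∈xs) = ≤-trans (≤-foldr-⊔ f x∈xs) (m≤n⊔m _ _)

^-distrib-* : ∀ a b m → (a * b) ^ m ≡ a ^ m * b ^ m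
^-distrib-* a b zero    = refl
^-distrib-* a b (suc m) =
  trans (cong (a * b *_) (^-distrib-* a b m)) (*-interchange a b (a ^ m) (b ^ m))

bernoulli : ∀ k m → k ^ m * (k + m) ≤ suc k ^ m * k
bernoulli k zero    = *-monoʳ-≤ 1 (≤-reflexive (+-identityʳ k))
bernoulli k (suc m) = begin
  k * k ^ m * (k + suc m)      ≡⟨ trans (*-assoc k (k ^ m) _) (*-left-comm k (k ^ m) _) ⟩
  k ^ m * (k * (k + suc m))    ≤⟨ *-monoʳ-≤ (k ^ m) (≤-trans (m≤m+n _ m) (≤-reflexive (expand k m))) ⟩
  k ^ m * ((k + m) * suc k)    ≡⟨ *-assoc (k ^ m) (k + m) (suc k) ⟨
  k ^ m * (k + m) * suc k      ≤⟨ *-monoˡ-≤ (suc k) (bernoulli k m) ⟩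
  suc k ^ m * k * suc k        ≡⟨ rotate (suc k ^ m) k (suc k) ⟩
  suc k * suc k ^ m * k        ∎
  where
  open ≤-Reasoning
  expand : ∀ k m → k * (k + suc m) + m ≡ (k + m) * suc k
  expand = solve-∀
  rotate : ∀ x y z → x * y * z ≡ z * x * y
  rotate = solve-∀

2*k^k≤[1+k]^k : ∀ k .{{_ : NonZero k}} → 2 * k ^ k ≤ suc k ^ k
2*k^k≤[1+k]^k k = *-cancelʳ-≤ (2 * k ^ k) (suc k ^ k) k (begin
  2 * k ^ k * k      ≡⟨ double (k ^ k) k ⟩
  k ^ k * (k + k)    ≤⟨ bernoulli k k ⟩
  suc k ^ k * k      ∎)
  where
  open ≤-Reasoning
  double : ∀ x k → 2 * x * k ≡ x * (k + k)
  double = solve-∀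

2^d≤N^k : ∀ {k N d} → 1 ≤ k → suc k ^ d ≤ N * k ^ d → 2 ^ d ≤ N ^ k
2^d≤N^k {k@(suc _)} {N} {d} _ [1+k]^d≤Nk^d =
  *-cancelʳ-≤ (2 ^ d) (N ^ k) (k ^ (k * d)) {{m^n≢0 k (k * d)}} (begin
    2 ^ d * k ^ (k * d)        ≡⟨ cong (2 ^ d *_) (^-*-assoc k k d) ⟨
    2 ^ d * (k ^ k) ^ d        ≡⟨ ^-distrib-* 2 (k ^ k) d ⟨
    (2 * k ^ k) ^ d            ≤⟨ ^-monoˡ-≤ d (2*k^k≤[1+k]^k k) ⟩
    (suc k ^ k) ^ d            ≡⟨ trans (^-*-assoc (suc k) k d) (cong (suc k ^_) (*-comm k d)) ⟩
    suc k ^ (d * k)            ≡⟨ ^-*-assoc (suc k) d k ⟨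
    (suc k ^ d) ^ k            ≤⟨ ^-monoˡ-≤ k [1+k]^d≤Nk^d ⟩
    (N * k ^ d) ^ k            ≡⟨ ^-distrib-* N (k ^ d) k ⟩
    N ^ k * (k ^ d) ^ k        ≡⟨ cong (N ^ k *_) (^-*-assoc k d k) ⟩
    N ^ k * k ^ (d * k)        ≡⟨ cong (λ e → N ^ k * k ^ e) (*-comm d k) ⟩
    N ^ k * k ^ (k * d)        ∎)
  where open ≤-Reasoning

module _ {A : Set} (_≟_ : DecidableEquality A) where

  position : A → List A → ℕ
  position x [] = 0
  position x (y ∷ ys) with x ≟ y
  ... | yes _ = 0
  ... | no  _ = suc (position x ys)

  position<length : ∀ {x xs} → x ∈ xs → position x xs < length xs
  position<length {x} {y ∷ ys} x∈ with x ≟ y | x∈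
  ... | yes _   | _          = s≤s z≤n
  ... | no  x≢y | here x≡y   = contradiction x≡y x≢y
  ... | no  _   | there x∈ys = s≤s (position<length x∈ys)

  position-injective : ∀ {x y xs} → x ∈ xs → y ∈ xs →
                       position x xs ≡ position y xs → x ≡ y
  position-injective {x} {y} {z ∷ zs} x∈ y∈ eq with x ≟ z | y ≟ z | x∈ | y∈
  ... | yes x≡z | yes y≡z | _          | _          = trans x≡z (sym y≡z)
  ... | no  x≢z | _       | here x≡z   | _          = contradiction x≡z x≢z
  ... | _       | no  y≢z | _          | here y≡z   = contradiction y≡z y≢z
  ... | no  _   | no  _   | there x∈zs | there y∈zs =
    position-injective x∈zs y∈zs (suc-injective eq)

  ∈-take⁺ : ∀ {x} k {xs} → x ∈ xs → position x xs < k → x ∈ take k xs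
  ∈-take⁺ {x} (suc k) {y ∷ ys} x∈ x<k with x ≟ y | x∈ | x<k
  ... | yes x≡y | _          | _       = here x≡y
  ... | no  x≢y | here x≡y   | _       = contradiction x≡y x≢y
  ... | no  _   | there x∈ys | s≤s x<k = there (∈-take⁺ k x∈ys x<k)

  ∈-take⁻ : ∀ {x} k {xs} → x ∈ take k xs → position x xs < k
  ∈-take⁻ {x} (suc k) {y ∷ ys} x∈ with x ≟ y | x∈
  ... | yes _   | _          = s≤s z≤n
  ... | no  x≢y | here x≡y   = contradiction x≡y x≢y
  ... | no  _   | there x∈ys = s≤s (∈-take⁻ k x∈ys)

lookup-injective : ∀ {A : Set} {xs : List A} → Unique xs →
                   ∀ {i j} → lookup xs i ≡ lookup xs j → i ≡ j
lookup-injective (_ ∷ _) {zero}  {zero}  _  = refl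
lookup-injective (x∉ ∷ _) {zero}  {suc j} eq = contradiction eq (All.lookup x∉ (∈-lookup j))
lookup-injective (x∉ ∷ _) {suc i} {zero}  eq = contradiction (sym eq) (All.lookup x∉ (∈-lookup i))
lookup-injective (_ ∷ u) {suc i} {suc j} eq = cong suc (lookup-injective u eq)

Unique⇒length≤ : ∀ {n} {xs : List (Fin n)} → Unique xs → length xs ≤ n
Unique⇒length≤ {xs = xs} u = injective⇒≤ {f = lookup xs} (lookup-injective u)

Unique-++⇒disjoint : ∀ {A : Set} {x : A} xs {ys} → Unique (xs ++ ys) → x ∈ xs → x ∉ ys
Unique-++⇒disjoint (_ ∷ xs) (x∉ ∷ _) (here refl) x∈ys = All.lookup x∉ (∈-++⁺ʳ xs x∈ys) refl
Unique-++⇒disjoint (_ ∷ xs) (_ ∷ u)  (there x∈xs) = Unique-++⇒disjoint xs u x∈xs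

Assignment : ℕ → Set
Assignment = Vector Bool

-- count only inspects assignments built from nil by _◂_, so a predicate that does not respect
-- _≗_ can only be reasoned about through counts, not pointwise.
count : ∀ {n} {P : Pred (Assignment n) 0ℓ} → Decidable P → ℕ
count {zero}  P? = if does (P? nil) then 1 else 0
count {suc n} P? = count (P? ∘ (true ◂_)) + count (P? ∘ (false ◂_))

count-mono : ∀ {n} {P Q : Pred (Assignment n) 0ℓ} (P? : Decidable P) (Q? : Decidable Q) →
             P ⊆ Q → count P? ≤ count Q?
count-mono {zero} P? Q? P⊆Q with P? nil | Q? nil
... | no _  | _     = z≤n
... | yes _ | yes _ = ≤-refl
... | yes p | no ¬q = ⊥-elim (¬q (P⊆Q p))
count-mono {suc n} P? Q? P⊆Q = +-mono-≤ (count-mono (P? ∘ (true ◂_)) (Q? ∘ (true ◂_)) P⊆Q)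
                                       (count-mono (P? ∘ (false ◂_)) (Q? ∘ (false ◂_)) P⊆Q)

count-empty : ∀ {n} {P : Pred (Assignment n) 0ℓ} (P? : Decidable P) → Empty P → count P? ≡ 0
count-empty {zero} P? ∅ with P? nil
... | yes p = ⊥-elim (∅ nil p)
... | no _  = refl
count-empty {suc n} P? ∅ = cong₂ _+_ (count-empty (P? ∘ (true ◂_)) (∅ ∘ (true ◂_)))
                                    (count-empty (P? ∘ (false ◂_)) (∅ ∘ (false ◂_)))

count-witness : ∀ {n} {P : Pred (Assignment n) 0ℓ} (P? : Decidable P) → count P? ≢ 0 → ∃ P
count-witness {zero} P? count≢0 with P? nil
... | yes p = nil , p
... | no _  = ⊥-elim (count≢0 refl)
count-witness {suc n} P? count≢0 with count (P? ∘ (true ◂_)) ≟ 0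
... | no c₁≢0 = let (A , p) = count-witness (P? ∘ (true ◂_)) c₁≢0 in true ◂ A , p
... | yes c₁≡0 =
  let (A , p) = count-witness (P? ∘ (false ◂_)) (λ c₀≡0 → count≢0 (cong₂ _+_ c₁≡0 c₀≡0))
  in false ◂ A , p

1≤count₀ : ∀ {P : Pred (Assignment 0) 0ℓ} (P? : Decidable P) → P nil → 1 ≤ count P?
1≤count₀ P? p with P? nil
... | yes _ = ≤-refl
... | no ¬p = ⊥-elim (¬p p)

count-slice-≤ : ∀ {n} {P : Pred (Assignment (suc n)) 0ℓ} (P? : Decidable P) b →
                count (P? ∘ (b ◂_)) ≤ count P?
count-slice-≤ P? true  = m≤m+n _ _
count-slice-≤ P? false = m≤n+m _ _

1≤count : ∀ {n} {P : Pred (Assignment n) 0ℓ} (P? : Decidable P) → P Respects _≗_ →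
          ∀ {A} → P A → 1 ≤ count P?
1≤count {zero}  P? resp p = 1≤count₀ P? (resp (λ ()) p)
1≤count {suc n} P? resp {A} p =
  ≤-trans (1≤count (P? ∘ (A zero ◂_)) (resp ∘ ◂-cong) (resp head◂tail p))
          (count-slice-≤ P? (A zero))
  where
  ◂-cong : ∀ {b} {A B : Assignment n} → A ≗ B → (b ◂ A) ≗ (b ◂ B)
  ◂-cong A≗B zero    = refl
  ◂-cong A≗B (suc v) = A≗B v
  head◂tail : A ≗ (A zero ◂ tail A)
  head◂tail zero    = refl
  head◂tail (suc v) = refl

count-≤-∑ : ∀ {n m} {P : Pred (Assignment n) 0ℓ} {Q : Fin m → Pred (Assignment n) 0ℓ}
            (P? : Decidable P) (Q? : ∀ i → Decidable (Q i)) →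
            (∀ {A} → P A → ∃ λ i → Q i A) → count P? ≤ sum (λ i → count (Q? i))
count-≤-∑ {zero} P? Q? cover with P? nil
... | no _  = z≤n
... | yes p = let (i , q) = cover p
              in ≤-trans (1≤count₀ (Q? i) q) (≤-∑ (λ i → count (Q? i)) i)
count-≤-∑ {suc n} P? Q? cover = begin
  count (P? ∘ (true ◂_)) + count (P? ∘ (false ◂_))
    ≤⟨ +-mono-≤ (count-≤-∑ (P? ∘ (true ◂_)) (λ i → Q? i ∘ (true ◂_)) cover)
                (count-≤-∑ (P? ∘ (false ◂_)) (λ i → Q? i ∘ (false ◂_)) cover) ⟩
  sum (λ i → count (Q? i ∘ (true ◂_))) + sum (λ i → count (Q? i ∘ (false ◂_)))
    ≡⟨ ∑-distrib-+ (λ i → count (Q? i ∘ (true ◂_))) (λ i → count (Q? i ∘ (false ◂_))) ⟨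
  sum (λ i → count (Q? i)) ∎
  where open ≤-Reasoning

count-split : ∀ {n} {P Q : Pred (Assignment n) 0ℓ} (P? : Decidable P) (Q? : Decidable Q) →
              count P? ≡ count (P? ∩? Q?) + count (P? ∩? ∁? Q?)
count-split {zero} P? Q? with P? nil | Q? nil
... | yes _ | yes _ = refl
... | yes _ | no _  = refl
... | no _  | _     = refl
count-split {suc n} P? Q? = begin
  c₁ + c₀                     ≡⟨ cong₂ _+_ (count-split (P? ∘ (true ◂_)) (Q? ∘ (true ◂_)))
                                            (count-split (P? ∘ (false ◂_)) (Q? ∘ (false ◂_))) ⟩
  (c₁⁺ + c₁⁻) + (c₀⁺ + c₀⁻)   ≡⟨ +-interchange c₁⁺ c₁⁻ c₀⁺ c₀⁻ ⟩
  (c₁⁺ + c₀⁺) + (c₁⁻ + c₀⁻)   ∎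
  where
  open ≡-Reasoning
  c₁ = count (P? ∘ (true ◂_))
  c₀ = count (P? ∘ (false ◂_))
  c₁⁺ = count ((P? ∩? Q?) ∘ (true ◂_))
  c₁⁻ = count ((P? ∩? ∁? Q?) ∘ (true ◂_))
  c₀⁺ = count ((P? ∩? Q?) ∘ (false ◂_))
  c₀⁻ = count ((P? ∩? ∁? Q?) ∘ (false ◂_))

count-≤-∀ : ∀ {n m} {P : Pred (Assignment n) 0ℓ} {Q : Fin m → Pred (Assignment n) 0ℓ}
            (P? : Decidable P) (Q? : ∀ j → Decidable (Q j)) →
            (∀ j → count (P? ∩? ∁? (Q? j)) ≡ 0) →
            count P? ≤ count (P? ∩? λ A → all? λ j → Q? j A)
count-≤-∀ {m = m} {P} {Q} P? Q? negligible = begin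
  count P?                                  ≡⟨ count-split P? ∀Q? ⟩
  count (P? ∩? ∀Q?) + count (P? ∩? ∁? ∀Q?)  ≤⟨ +-monoʳ-≤ (count (P? ∩? ∀Q?)) violations≤0 ⟩
  count (P? ∩? ∀Q?) + 0                     ≡⟨ +-identityʳ _ ⟩
  count (P? ∩? ∀Q?)                         ∎
  where
  open ≤-Reasoning
  ∀Q? = λ A → all? λ j → Q? j A
  violated : ∀ {A} → (P ∩ ∁ (λ A → ∀ j → Q j A)) A → ∃ λ j → (P ∩ ∁ (Q j)) A
  violated {A} (pA , ¬∀Q) = let (j , ¬Qj) = ¬∀⟶∃¬ m _ (λ j → Q? j A) ¬∀Q in j , pA , ¬Qj
  violations≤0 : count (P? ∩? ∁? ∀Q?) ≤ 0
  violations≤0 = begin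
    count (P? ∩? ∁? ∀Q?)                 ≤⟨ count-≤-∑ _ (λ j → P? ∩? ∁? (Q? j)) violated ⟩
    sum (λ j → count (P? ∩? ∁? (Q? j)))  ≤⟨ ∑-mono-≤ (≤-reflexive ∘ negligible) ⟩
    sum {m} (λ _ → 0)                    ≡⟨ ∑-const m 0 ⟩
    m * 0                                ≡⟨ *-zeroʳ m ⟩
    0                                    ∎

override : ∀ {n} → (S δ A : Assignment n) → Assignment n
override S δ A v = if S v then δ v else A v

override-inside : ∀ {n} {S δ A B : Assignment n} {v} →
                  B ≗ override S δ A → S v ≡ true → B v ≡ δ v
override-inside {δ = δ} {A} {v = v} B≗ Sv = trans (B≗ v) (cong (λ s → if s then δ v else A v) Sv)

override-outside : ∀ {n} {S δ A B : Assignment n} {v} →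
                   B ≗ override S δ A → S v ≡ false → B v ≡ A v
override-outside {δ = δ} {A} {v = v} B≗ Sv = trans (B≗ v) (cong (λ s → if s then δ v else A v) Sv)

weight : ∀ {n} → Assignment n → ℕ
weight S = sum (λ v → if S v then 1 else 0)

◂≗override : ∀ {n} {S δ : Assignment (suc n)} {A B : Assignment n} {b b′} →
             b′ ≡ (if S zero then δ zero else b) → B ≗ override (tail S) (tail δ) A →
             (b′ ◂ B) ≗ override S δ (b ◂ A)
◂≗override b′≡ B≗ zero    = b′≡
◂≗override b′≡ B≗ (suc v) = B≗ v

count-override : ∀ {n} {P Q : Pred (Assignment n) 0ℓ} (P? : Decidable P) (Q? : Decidable Q)
                 (S δ : Assignment n) → (∀ {A B} → B ≗ override S δ A → P A → Q B) →
                 count P? ≤ 2 ^ weight S * count Q?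
count-override {zero} P? Q? S δ P⇒Q with P? nil | Q? nil
... | no _  | _     = z≤n
... | yes _ | yes _ = ≤-refl
... | yes p | no ¬q = ⊥-elim (¬q (P⇒Q (λ ()) p))
count-override {suc n} P? Q? S δ P⇒Q with S zero in S₀
... | true = begin
  count (P? ∘ (true ◂_)) + count (P? ∘ (false ◂_))  ≤⟨ +-mono-≤ (slice true) (slice false) ⟩
  k * c + k * c       ≡⟨ *-distribʳ-+ c k k ⟨
  (k + k) * c         ≡⟨ cong (λ m → (k + m) * c) (+-identityʳ k) ⟨
  2 * k * c           ≤⟨ *-monoʳ-≤ (2 * k) (count-slice-≤ Q? (δ zero)) ⟩
  2 * k * count Q?    ∎
  where
  open ≤-Reasoning
  k = 2 ^ weight (tail S)
  c = count (Q? ∘ (δ zero ◂_))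
  slice : ∀ b → count (P? ∘ (b ◂_)) ≤ k * c
  slice b = count-override (P? ∘ (b ◂_)) (Q? ∘ (δ zero ◂_)) (tail S) (tail δ) λ B≗ →
    P⇒Q (◂≗override {S = S} {δ} (cong (λ s → if s then δ zero else b) (sym S₀)) B≗)
... | false = begin
  count (P? ∘ (true ◂_)) + count (P? ∘ (false ◂_))          ≤⟨ +-mono-≤ (slice true) (slice false) ⟩
  k * count (Q? ∘ (true ◂_)) + k * count (Q? ∘ (false ◂_))  ≡⟨ *-distribˡ-+ k _ _ ⟨
  k * count Q?                                              ∎
  where
  open ≤-Reasoning
  k = 2 ^ weight (tail S)
  slice : ∀ b → count (P? ∘ (b ◂_)) ≤ k * count (Q? ∘ (b ◂_))
  slice b = count-override (P? ∘ (b ◂_)) (Q? ∘ (b ◂_)) (tail S) (tail δ) λ B≗ →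
    P⇒Q (◂≗override {S = S} {δ} (cong (λ s → if s then δ zero else b) (sym S₀)) B≗)

weight-insert : ∀ {n} (w : Fin n) (S : Assignment n) →
                weight (λ v → does (v ≟ᶠ w) ∨ S v) ≤ suc (weight S)
weight-insert zero    S = s≤s (m≤n+m _ _)
weight-insert (suc w) S =
  ≤-trans (+-monoʳ-≤ s₀ (weight-insert w (tail S))) (≤-reflexive (+-suc s₀ (weight (tail S))))
  where s₀ = if S zero then 1 else 0

TrueAt : ∀ {n} → Fin n → Pred (Assignment n) 0ℓ
TrueAt w A = A w ≡ true

trueAt? : ∀ {n} (w : Fin n) → Decidable (TrueAt w)
trueAt? w A = A w Bool.≟ true

AllTrue : ∀ {n d} → (Fin d → Fin n) → Pred (Assignment n) 0ℓ
AllTrue W A = ∀ j → TrueAt (W j) A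

allTrue? : ∀ {n d} (W : Fin d → Fin n) → Decidable (AllTrue W)
allTrue? W A = all? λ j → trueAt? (W j) A

module _ {n : ℕ} where
  open DecMembership (_≟ᶠ_ {n}) using (_∈?_)

  mix : List (Fin n) → Assignment n → Assignment n → Assignment n
  mix X A A′ v = if does (v ∈? X) then A v else A′ v

  mix-∈ : ∀ {X A A′ v} → v ∈ X → mix X A A′ v ≡ A v
  mix-∈ {X} {A} {A′} {v} v∈X = cong (λ b → if b then A v else A′ v) (dec-true (v ∈? X) v∈X)

  mix-∉ : ∀ {X A A′ v} → v ∉ X → mix X A A′ v ≡ A′ v
  mix-∉ {X} {A} {A′} {v} v∉X = cong (λ b → if b then A v else A′ v) (dec-false (v ∈? X) v∉X)

module _ {n : ℕ} (G : Graph n) where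
  open Graph G

  satisfies? : Decidable (SatPhi G)
  satisfies? A = all? λ u → all? λ v → (adj u v Bool.≟ true) →-dec (trueAt? u A ⊎-dec trueAt? v A)

  satisfies-resp-≗ : SatPhi G Respects _≗_
  satisfies-resp-≗ A≗B satA u v uv =
    Sum.map (trans (sym (A≗B u))) (trans (sym (A≗B v))) (satA u v uv)

  degree≤maxDegree : ∀ w → degree G w ≤ maxDegree G
  degree≤maxDegree w = ≤-foldr-⊔ (degree G) (∈-allFin w)

  N[_] : Fin n → Assignment n
  N[ w ] v = does (v ≟ᶠ w) ∨ adj w v

  weight-N≤ : ∀ w → weight N[ w ] ≤ suc (maxDegree G)
  weight-N≤ w = begin
    weight N[ w ]                   ≤⟨ weight-insert w (adj w) ⟩
    suc (weight (adj w))            ≡⟨ cong suc (List-sum-tabulate adjᵢ) ⟨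
    suc (List.sum (tabulate adjᵢ))  ≡⟨ cong (suc ∘ List.sum) (map-tabulate (λ v → v) adjᵢ) ⟨
    suc (degree G w)                ≤⟨ s≤s (degree≤maxDegree w) ⟩
    suc (maxDegree G)               ∎
    where
    open ≤-Reasoning
    adjᵢ : Fin n → ℕ
    adjᵢ v = if adj w v then 1 else 0

  raise-neighbourhood : ∀ {A B} w → SatPhi G A → (∀ {v} → Adj G w v → B v ≡ true) →
                        (∀ {v} → v ≢ w → ¬ Adj G w v → B v ≡ A v) → SatPhi G B
  raise-neighbourhood w satA raised kept a b ab with adj w a in wa | adj w b in wb
  ... | true  | _     = inj₁ (raised wa)
  ... | false | true  = inj₂ (raised wb)
  ... | false | false =
    Sum.map (trans (kept a≢w (false≢ wa))) (trans (kept b≢w (false≢ wb))) (satA a b ab)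
    where
    false≢ : ∀ {x} → adj w x ≡ false → ¬ Adj G w x
    false≢ wx≡f wx≡t = contradiction (trans (sym wx≡f) wx≡t) λ ()
    a≢w : a ≢ w
    a≢w refl = false≢ wb ab
    b≢w : b ≢ w
    b≢w refl = false≢ wa (trans (adj-sym w a) ab)

  IsIndependent : ∀ {d} → (Fin d → Fin n) → Set
  IsIndependent W = ∀ i j → i ≢ j → W i ≢ W j × ¬ Adj G (W i) (W j)

  adj⇒≢ : ∀ {w v} → Adj G w v → v ≢ w
  adj⇒≢ {w} wv refl = contradiction (trans (sym (irrefl w)) wv) λ ()

  SatAll : ∀ {d} → (Fin d → Fin n) → Pred (Assignment n) 0ℓ
  SatAll W = SatPhi G ∩ AllTrue W

  satAll? : ∀ {d} (W : Fin d → Fin n) → Decidable (SatAll W)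
  satAll? W = satisfies? ∩? allTrue? W

  K : ℕ
  K = 2 ^ suc (maxDegree G)

  -- Overriding N[w] by "w false, neighbours true" maps the first set into the second and is
  -- at most 2 ^ weight N[w] ≤ K to one.
  count-trueAt-≤ : ∀ {d} w (W : Fin d → Fin n) → (∀ j → W j ≢ w × ¬ Adj G w (W j)) →
                   count (satAll? W ∩? trueAt? w) ≤ K * count (satAll? W ∩? ∁? (trueAt? w))
  count-trueAt-≤ w W far =
    ≤-trans (count-override (satAll? W ∩? trueAt? w) (satAll? W ∩? ∁? (trueAt? w)) N[ w ] δ raise)
            (*-monoˡ-≤ _ (^-monoʳ-≤ 2 (weight-N≤ w)))
    where
    δ : Assignment n
    δ v = not (does (v ≟ᶠ w))
    N-self : N[ w ] w ≡ true
    N-self = cong (_∨ adj w w) (dec-true (w ≟ᶠ w) refl)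
    N-adj : ∀ {v} → Adj G w v → N[ w ] v ≡ true
    N-adj {v} wv = trans (cong (does (v ≟ᶠ w) ∨_) wv) (Bool.∨-zeroʳ _)
    N-far : ∀ {v} → v ≢ w → ¬ Adj G w v → N[ w ] v ≡ false
    N-far {v} v≢w ¬wv = cong₂ _∨_ (dec-false (v ≟ᶠ w) v≢w) (Bool.¬-not ¬wv)
    raise : ∀ {A B} → B ≗ override N[ w ] δ A →
            (SatAll W ∩ TrueAt w) A → (SatAll W ∩ ∁ (TrueAt w)) B
    raise {A} {B} B≗ ((satA , allA) , _) = (raise-neighbourhood w satA raised kept , allB) , Bw≢true
      where
      raised : ∀ {v} → Adj G w v → B v ≡ true
      raised {v} wv = trans (override-inside {S = N[ w ]} {δ} B≗ (N-adj wv))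
                            (cong not (dec-false (v ≟ᶠ w) (adj⇒≢ wv)))
      kept : ∀ {v} → v ≢ w → ¬ Adj G w v → B v ≡ A v
      kept v≢w ¬wv = override-outside {S = N[ w ]} {δ} B≗ (N-far v≢w ¬wv)
      allB : AllTrue W B
      allB j = trans (kept (proj₁ (far j)) (proj₂ (far j))) (allA j)
      Bw≡false : B w ≡ false
      Bw≡false = trans (override-inside {S = N[ w ]} {δ} B≗ N-self)
                       (cong not (dec-true (w ≟ᶠ w) refl))
      Bw≢true : ¬ TrueAt w B
      Bw≢true Bw = contradiction (trans (sym Bw≡false) Bw) λ ()

  count-satAll : ∀ {d} (W : Fin d → Fin n) → IsIndependent W →
                 count (satAll? W) * suc K ^ d ≤ count satisfies? * K ^ d
  count-satAll {zero}  W _ = *-monoˡ-≤ 1 (count-mono (satAll? W) satisfies? proj₁)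
  count-satAll {suc d} W indep = begin
    c * (suc K * suc K ^ d)  ≡⟨ *-assoc c (suc K) _ ⟨
    c * suc K * suc K ^ d    ≤⟨ *-monoˡ-≤ (suc K ^ d) c[1+K]≤Kc′ ⟩
    K * c′ * suc K ^ d       ≡⟨ *-assoc K c′ _ ⟩
    K * (c′ * suc K ^ d)     ≤⟨ *-monoʳ-≤ K (count-satAll W′ indep′) ⟩
    K * (s * K ^ d)          ≡⟨ *-left-comm K s (K ^ d) ⟩
    s * (K * K ^ d)          ∎
    where
    open ≤-Reasoning
    w = W zero
    W′ = W ∘ suc
    indep′ : IsIndependent W′
    indep′ i j i≢j = indep (suc i) (suc j) (i≢j ∘ Fin.suc-injective)
    s = count satisfies?
    c = count (satAll? W)
    c′ = count (satAll? W′)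
    c₁ = count (satAll? W′ ∩? trueAt? w)
    c₀ = count (satAll? W′ ∩? ∁? (trueAt? w))
    c≤c₁ : c ≤ c₁
    c≤c₁ = count-mono (satAll? W) (satAll? W′ ∩? trueAt? w)
                      λ (satA , allA) → (satA , allA ∘ suc) , allA zero
    c₁≤Kc₀ : c₁ ≤ K * c₀
    c₁≤Kc₀ = count-trueAt-≤ w W′ λ j →
               let (w≢ , ¬adj) = indep zero (suc j) (λ ()) in ≢-sym w≢ , ¬adj
    c[1+K]≤Kc′ : c * suc K ≤ K * c′
    c[1+K]≤Kc′ = begin
      c * suc K         ≤⟨ *-monoˡ-≤ (suc K) c≤c₁ ⟩
      c₁ * suc K        ≤⟨ *-suc-≤ c₁≤Kc₀ ⟩
      K * (c₁ + c₀)     ≡⟨ cong (K *_) (count-split (satAll? W′) (trueAt? w)) ⟨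
      K * c′            ∎

  list-ordering : (L : List (Fin n)) → Unique L → (∀ v → v ∈ L) →
                  Σ (Ordering G) λ σ → ∀ k v → InPrefix G σ k v ⇔ v ∈ take k L
  list-ordering L unique complete = (σ , σ-injective) , λ k v → mk⇔ (to k) (from k)
    where
    position<n : ∀ v → position _≟ᶠ_ v L < n
    position<n v = ≤-trans (position<length _≟ᶠ_ (complete v)) (Unique⇒length≤ unique)
    σ : Fin n → Fin n
    σ v = fromℕ< (position<n v)
    toℕ-σ : ∀ v → toℕ (σ v) ≡ position _≟ᶠ_ v L
    toℕ-σ v = toℕ-fromℕ< (position<n v)
    σ-injective : Injective _≡_ _≡_ σ
    σ-injective {v} {w} σv≡σw =
      position-injective _≟ᶠ_ (complete v) (complete w)
        (trans (sym (toℕ-σ v)) (trans (cong toℕ σv≡σw) (toℕ-σ w)))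
    to : ∀ k {v} → toℕ (σ v) < k → v ∈ take k L
    to k {v} σv<k = ∈-take⁺ _≟ᶠ_ k (complete v) (subst (_< k) (toℕ-σ v) σv<k)
    from : ∀ k {v} → v ∈ take k L → toℕ (σ v) < k
    from k {v} v∈ = subst (_< k) (sym (toℕ-σ v)) (∈-take⁻ _≟ᶠ_ k v∈)

module _ {n : ℕ} (B : BP n) where
  open BP B

  _++ₚ_ : ∀ {s m t} → Path B s m → Path B m t → Path B s t
  []      ++ₚ r = r
  (e ∷ q) ++ₚ r = e ∷ (q ++ₚ r)

  literals-++ : ∀ {s m t} (q : Path B s m) (r : Path B m t) →
                literals B (q ++ₚ r) ≡ literals B q ++ literals B r
  literals-++ []      r = refl
  literals-++ (e ∷ q) r with lab e
  ... | just l  = cong (l ∷_) (literals-++ q r)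
  ... | nothing = literals-++ q r

  literals-just : ∀ {t} e (q : Path B (tgt e) t) {l} →
                  lab e ≡ just l → literals B (e ∷ q) ≡ l ∷ literals B q
  literals-just e q le with lab e
  literals-just e q refl | just _ = refl

  literals-nothing : ∀ {t} e (q : Path B (tgt e) t) →
                     lab e ≡ nothing → literals B (e ∷ q) ≡ literals B q
  literals-nothing e q le with lab e
  literals-nothing e q refl | nothing = refl

  split-after : ∀ {s t} k (p : Path B s t) →
                ∃ λ m → Σ (Path B s m) λ q → Σ (Path B m t) λ r →
                  q ++ₚ r ≡ p × literals B q ≡ take k (literals B p)
  split-after {s} zero p = s , [] , p , refl , refl
  split-after (suc k) [] = _ , [] , [] , refl , refl
  split-after (suc k) (e ∷ p) with lab e in le
  ... | just l  = let (m , q , r , q++r≡p , lits) = split-after k p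
                  in m , e ∷ q , r , cong (e ∷_) q++r≡p ,
                     trans (literals-just e q le) (cong (l ∷_) lits)
  ... | nothing = let (m , q , r , q++r≡p , lits) = split-after (suc k) p
                  in m , e ∷ q , r , cong (e ∷_) q++r≡p , trans (literals-nothing e q le) lits

  vars-++ : ∀ {s m t} (q : Path B s m) (r : Path B m t) →
            vars B (q ++ₚ r) ≡ vars B q ++ vars B r
  vars-++ q r =
    trans (cong (map proj₁) (literals-++ q r)) (map-++ proj₁ (literals B q) (literals B r))

  splice-sound : ∀ {F : Pred (Assignment n) 0ℓ} → ReadOnce B → Uniform B →
                 (∀ (p : Path B root leaf) A → Extends B A (literals B p) → F A) →
                 ∀ {u} (q q′ : Path B root u) (r′ : Path B u leaf) {A A′} →
                 Extends B A (literals B q) → Extends B A′ (literals B r′) →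
                 F (mix (vars B q) A A′)
  splice-sound readOnce uniform sound q q′ r′ {A} {A′} A-q A′-r′ =
    sound (q ++ₚ r′) C (subst (Extends B C) (sym (literals-++ q r′)) (All.++⁺ C-q C-r′))
    where
    C = mix (vars B q) A A′
    q′r′-unique : Unique (vars B q′ ++ vars B r′)
    q′r′-unique = subst Unique (vars-++ q′ r′) (readOnce root leaf (q′ ++ₚ r′))
    C-q : Extends B C (literals B q)
    C-q = All.tabulate λ l∈ → trans (mix-∈ {A = A} {A′} (∈-map⁺ proj₁ l∈)) (All.lookup A-q l∈)
    q∩r′=∅ : ∀ {x} → x ∈ vars B q → x ∉ vars B r′
    q∩r′=∅ x∈q = Unique-++⇒disjoint (vars B q′) q′r′-unique (proj₁ uniform _ q q′ _ x∈q)
    C-r′ : Extends B C (literals B r′)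
    C-r′ = All.tabulate λ l∈ →
      trans (mix-∉ {A = A} {A′} λ x∈q → q∩r′=∅ x∈q (∈-map⁺ proj₁ l∈)) (All.lookup A′-r′ l∈)

module _ {n : ℕ} (G : Graph n) {d : ℕ} (dmw : IsDMW G d) (B : BP n)
         (nrobp : IsNROBP B (SatPhi G)) (uniform : Uniform B) where
  open BP B

  readOnce : ReadOnce B
  readOnce = proj₁ (proj₂ (proj₂ nrobp))

  sound : ∀ (p : Path B root leaf) A → Extends B A (literals B p) → SatPhi G A
  sound = proj₁ (proj₂ (proj₂ (proj₂ nrobp)))

  complete : ∀ A → SatPhi G A → Σ (Path B root leaf) λ p → Extends B A (literals B p)
  complete = proj₂ (proj₂ (proj₂ (proj₂ nrobp)))

  uniform-vars : ∀ {u u′} → u ≡ u′ → (q : Path B root u) (q′ : Path B root u′) →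
                 ∀ {x} → x ∈ vars B q → x ∈ vars B q′
  uniform-vars refl q q′ {x} = proj₁ uniform _ q q′ x

  splice-edge : ∀ {u u′ A A′} (q : Path B root u) (q′ : Path B root u′) (r′ : Path B u′ leaf) →
                u ≡ u′ → Extends B A (literals B q) → Extends B A′ (literals B r′) →
                ∀ {a b} → Adj G a b → a ∈ vars B q → b ∉ vars B q → A a ≡ true ⊎ A′ b ≡ true
  splice-edge {A = A} {A′} q q′ r′ refl A-q A′-r′ {a} {b} ab a∈q b∉q =
    Sum.map (trans (sym (mix-∈ {A = A} {A′} a∈q))) (trans (sym (mix-∉ {A = A} {A′} b∉q)))
            (splice-sound B readOnce uniform sound q q′ r′ A-q A′-r′ a b ab)

  record Cut (A : Assignment n) : Set where
    field
      node           : Fin nodes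
      prefix         : Path B root node
      suffix         : Path B node leaf
      prefix-extends : Extends B A (literals B prefix)
      suffix-extends : Extends B A (literals B suffix)
      matching       : Fin d → Fin n × Fin n
      distant        : IsDistantMatching G matching
      left-in        : ∀ j → proj₁ (matching j) ∈ vars B prefix
      right-out      : ∀ j → proj₂ (matching j) ∉ vars B prefix

  cut : ∀ A → SatPhi G A → Cut A
  cut A satA =
    let (p , A-p)          = complete A satA
        (σ , prefix⇔)      = list-ordering G (vars B p) (readOnce root leaf p) (proj₂ uniform p)
        (i , M , crossing) = proj₂ dmw σ
        k                  = toℕ i
        (m , q , r , q++r≡p , literals-q) = split-after B k p
        literals-p : literals B p ≡ literals B q ++ literals B r
        literals-p = trans (cong (literals B) (sym q++r≡p)) (literals-++ B q r)
        (A-q , A-r) = All.++⁻ (literals B q) (subst (Extends B A) literals-p A-p)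
        vars-q : vars B q ≡ take k (vars B p)
        vars-q = trans (cong (map proj₁) literals-q) (sym (take-map k (literals B p)))
    in record
      { node = m ; prefix = q ; suffix = r ; prefix-extends = A-q ; suffix-extends = A-r
      ; matching = M ; distant = proj₁ crossing
      ; left-in   = λ j → subst (proj₁ (M j) ∈_) (sym vars-q)
                            (Equivalence.to (prefix⇔ k _) (proj₁ (proj₂ crossing j)))
      ; right-out = λ j b∈q → proj₂ (proj₂ crossing j)
                                (Equivalence.from (prefix⇔ k _) (subst (proj₂ (M j) ∈_) vars-q b∈q))
      }

  -- root is a junk value: InClass only considers satisfying assignments.
  nodeOf : ∀ A → Dec (SatPhi G A) → Fin nodes
  nodeOf A (yes satA) = Cut.node (cut A satA)
  nodeOf A (no _)     = root

  InClass : Fin nodes → Pred (Assignment n) 0ℓ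
  InClass u A = SatPhi G A × nodeOf A (satisfies? G A) ≡ u

  inClass? : ∀ u → Decidable (InClass u)
  inClass? u A = satisfies? G A ×-dec (nodeOf A (satisfies? G A) ≟ᶠ u)

  class-cut : ∀ {u A} → InClass u A → Σ (Cut A) λ c → Cut.node c ≡ u
  class-cut {u} {A} (satA , node≡u) with satisfies? G A
  ... | yes satA′ = cut A satA′ , node≡u
  ... | no ¬satA  = contradiction satA ¬satA

  -- If some assignment of the class falsifies a, splicing its prefix (which reads a but not b)
  -- with the suffix of any other assignment of the class shows that the latter sets b.
  forced-endpoint : ∀ {u₀ u} (q₀ : Path B root u₀) → u₀ ≡ u →
                    ∀ {a b} → Adj G a b → a ∈ vars B q₀ → b ∉ vars B q₀ →
                    Σ (Fin n) λ w → (w ≡ a ⊎ w ≡ b) × count (inClass? u ∩? ∁? (trueAt? w)) ≡ 0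
  forced-endpoint {u = u} q₀ u₀≡u {a} {b} ab a∈q₀ b∉q₀
    with count (inClass? u ∩? ∁? (trueAt? a)) ≟ 0
  ... | yes none = a , inj₁ refl , none
  ... | no some with count-witness (inClass? u ∩? ∁? (trueAt? a)) some
  ...   | A₁ , inA₁ , A₁a≢true with class-cut inA₁
  ...     | c₁ , c₁≡u =
    b , inj₂ refl , count-empty (inClass? u ∩? ∁? (trueAt? b)) λ A (inA , Ab≢true) → Ab≢true (b-true inA)
    where
    q₁ = Cut.prefix c₁
    a∈q₁ : a ∈ vars B q₁
    a∈q₁ = uniform-vars (trans u₀≡u (sym c₁≡u)) q₀ q₁ a∈q₀
    b∉q₁ : b ∉ vars B q₁
    b∉q₁ b∈q₁ = b∉q₀ (uniform-vars (trans c₁≡u (sym u₀≡u)) q₁ q₀ b∈q₁)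
    b-true : ∀ {A} → InClass u A → A b ≡ true
    b-true inA with class-cut inA
    ... | c , c≡u with splice-edge q₁ (Cut.prefix c) (Cut.suffix c) (trans c₁≡u (sym c≡u))
                                   (Cut.prefix-extends c₁) (Cut.suffix-extends c) ab a∈q₁ b∉q₁
    ...   | inj₁ A₁a = contradiction A₁a A₁a≢true
    ...   | inj₂ Ab  = Ab

  class-bound : ∀ u → count (inClass? u) * suc (K G) ^ d ≤ count (satisfies? G) * K G ^ d
  class-bound u with count (inClass? u) ≟ 0
  ... | yes empty rewrite empty = z≤n
  ... | no nonempty = ≤-trans (*-monoˡ-≤ _ class≤satAll) (count-satAll G W W-independent)
    where
    c₀ = class-cut (proj₂ (count-witness (inClass? u) nonempty))
    open Cut (proj₁ c₀)
    forced : ∀ j → Σ (Fin n) λ w →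
               Incident G w (matching j) × count (inClass? u ∩? ∁? (trueAt? w)) ≡ 0
    forced j = forced-endpoint prefix (proj₂ c₀) (proj₁ distant j) (left-in j) (right-out j)
    W : Fin d → Fin n
    W = proj₁ ∘ forced
    W-incident : ∀ j → Incident G (W j) (matching j)
    W-incident = proj₁ ∘ proj₂ ∘ forced
    W-independent : IsIndependent G W
    W-independent i j i≢j =
      let (W≢ , ¬adj , _) = proj₂ distant i j i≢j (W i) (W j) (W-incident i) (W-incident j)
      in W≢ , ¬adj
    class≤satAll : count (inClass? u) ≤ count (satAll? G W)
    class≤satAll = ≤-trans (count-≤-∀ (inClass? u) (trueAt? ∘ W) (proj₂ ∘ proj₂ ∘ forced))
                           (count-mono _ (satAll? G W) λ ((satA , _) , allA) → satA , allA)

  node-count : suc (K G) ^ d ≤ nodes * K G ^ d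
  node-count = *-cancelˡ-≤ s {{>-nonZero 1≤s}} (begin
    s * suc k ^ d                               ≤⟨ *-monoˡ-≤ _ (count-≤-∑ (satisfies? G) inClass? classified) ⟩
    sum (λ u → count (inClass? u)) * suc k ^ d  ≡⟨ *-distribʳ-sum (suc k ^ d) (λ u → count (inClass? u)) ⟩
    sum (λ u → count (inClass? u) * suc k ^ d)  ≤⟨ ∑-mono-≤ class-bound ⟩
    sum {nodes} (λ _ → s * k ^ d)               ≡⟨ ∑-const nodes (s * k ^ d) ⟩
    nodes * (s * k ^ d)                         ≡⟨ *-left-comm nodes s (k ^ d) ⟩
    s * (nodes * k ^ d)                         ∎)
    where
    open ≤-Reasoning
    k = K G
    s = count (satisfies? G)
    1≤s : 1 ≤ s
    1≤s = 1≤count (satisfies? G) (satisfies-resp-≗ G) {λ _ → true} λ _ _ _ → inj₁ refl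
    classified : ∀ {A} → SatPhi G A → ∃ λ u → InClass u A
    classified {A} satA = nodeOf A (satisfies? G A) , satA , refl

theorem2 : Σ (ℕ → ℕ) λ a → (∀ i → 1 ≤ a i) ×
    (∀ {n : ℕ} (G : Graph n) → NoIsolated G →
      ∀ (d : ℕ) → IsDMW G d →
      ∀ (B : BP n) → IsNROBP B (SatPhi G) → Uniform B →
      2 ^ d ≤ BP.nodes B ^ a (maxDegree G))
theorem2 = (λ Δ → 2 ^ suc Δ) , (λ Δ → m^n>0 2 (suc Δ)) ,
  λ G _ d dmw B nrobp uniform →
    2^d≤N^k {N = BP.nodes B} {d} (m^n>0 2 (suc (maxDegree G))) (node-count G dmw B nrobp uniform)
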